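{- Let $m\ge2$, $e=\binom m2$, $n\ge 3$, and let $D^{(1)},\dots,D^{(n)}\in\mathbb{R}^e/\mathbb{R}\mathbf{1}$ be ultrametrics. Then there exists a tropical Fermat–Weber point $x^*$ of $\{D^{(1)},\dots,D^{(n)}\}$ lying in $\mathrm{tconv}(D^{(1)},\dots,D^{(n)})$; in particular, this $x^*$ is an ultrametric.
   Context: Max-plus arithmetic: $a\oplus b=\max\{a,b\}$, $a\odot b=a+b$, coordinatewise on vectors. $\mathbb{R}^e/\mathbb{R}\mathbf{1}$ is the quotient by the all-ones vector, coordinates indexed by pairs $\{i,j\}\subseteq[m]$. The tropical distance is $d_{\mathrm{tr}}(v,w)=\max_{i<j}|v_i-w_i-v_j+w_j|$. $\mathrm{tconv}(V)$ is the set of tropical linear combinations $a_1\odot v_1\oplus\cdots\oplus a_r\odot v_r$ with $v_i\in V$, $a_i\in\mathbb{R}$. A Fermat–Weber point of $\{D^{(1)},\dots,D^{(n)}\}$ is any $x^*\in\operatorname{argmin}_{x\in\mathbb{R}^e/\mathbb{R}\mathbf{1}}\sum_{i=1}^n d_{\mathrm{tr}}(x,D^{(i)})$. A point of $\mathbb{R}^e/\mathbb{R}\mathbf{1}$ is an ultrametric if it is the class of a metric $d$ on $[m]$ satisfying $d(i,k)\le\max(d(i,j),d(j,k))$ for all $i,j,k$; equivalently, for each triple $i<j<k$ the maximum of $x_{ij},x_{ik},x_{jk}$ is attained at least twice. -}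

module Defs where

open import Level using (0ℓ)
open import Data.Nat using (ℕ; zero; suc)
open import Data.Fin using (Fin; _<_; _<?_)
import Data.Fin as Fin
open import Data.Product using (Σ; ∃; _×_; _,_)
open import Data.Sum using (_⊎_)
open import Relation.Nullary using (¬_; yes; no)
open import Relation.Binary.Core using (Rel)
open import Relation.Binary.Definitions using (Decidable)
open import Relation.Binary.Structures using (IsTotalOrder)
open import Relation.Binary.PropositionalEquality using (_≡_)
open import Algebra.Structures using (IsCommutativeRing)

record RealField : Set₁ where
  infixl 6 _+_
  infixl 7 _*_
  infix 4 _≤_
  field
    Carrier : Set
    _+_ _*_ : Carrier → Carrier → Carrier
    -_ : Carrier → Carrier
    0# 1# : Carrier
    _≤_ : Rel Carrier 0ℓ
    isCommutativeRing : IsCommutativeRing _≡_ _+_ _*_ -_ 0# 1#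
    0≢1 : ¬ (0# ≡ 1#)
    inverse : ∀ x → ¬ (x ≡ 0#) → Σ Carrier (λ y → x * y ≡ 1#)
    isTotalOrder : IsTotalOrder _≡_ _≤_
    _≤?_ : Decidable _≤_
    +-monoˡ-≤ : ∀ {x y} z → x ≤ y → x + z ≤ y + z
    *-nonneg : ∀ {x y} → 0# ≤ x → 0# ≤ y → 0# ≤ x * y
    supremum : (P : Carrier → Set) → Σ Carrier P →
               Σ Carrier (λ b → ∀ x → P x → x ≤ b) →
               Σ Carrier (λ s → (∀ x → P x → x ≤ s) ×
                                (∀ b → (∀ x → P x → x ≤ b) → s ≤ b))

module Over (R : RealField) where
  open RealField R

  _-_ : Carrier → Carrier → Carrier
  x - y = x + (- y)

  max : Carrier → Carrier → Carrier
  max x y with x ≤? y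
  ... | yes _ = y
  ... | no _ = x

  ∣_∣ : Carrier → Carrier
  ∣ x ∣ = max x (- x)

  -- maximum of a finite nonempty family (value 0# for the empty family,
  -- never used on empty families below)
  bigMax : (k : ℕ) → (Fin k → Carrier) → Carrier
  bigMax zero f = 0#
  bigMax (suc zero) f = f Fin.zero
  bigMax (suc (suc k)) f = max (f Fin.zero) (bigMax (suc k) (λ i → f (Fin.suc i)))

  bigSum : (k : ℕ) → (Fin k → Carrier) → Carrier
  bigSum zero f = 0#
  bigSum (suc k) f = f Fin.zero + bigSum k (λ i → f (Fin.suc i))

  -- A point of R^e (e = m choose 2): coordinate {i,j} with i < j is x i j.
  -- Entries x i j with ¬ (i < j) are ignored by every notion below.
  Pt : ℕ → Set
  Pt m = Fin m → Fin m → Carrier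

  -- same class in R^e / R1
  _∼_ : ∀ {m} → Pt m → Pt m → Set
  _∼_ {m} x y = Σ Carrier λ c → ∀ (i j : Fin m) → i < j → x i j ≡ y i j + c

  term : ∀ {m} → Pt m → Pt m → Fin m → Fin m → Fin m → Fin m → Carrier
  term v w i j k l with i <? j | k <? l
  ... | yes _ | yes _ = ∣ ((v i j - w i j) - v k l) + w k l ∣
  ... | _ | _ = 0#

  dtr : ∀ {m} → Pt m → Pt m → Carrier
  dtr {m} v w = bigMax m λ i → bigMax m λ j → bigMax m λ k → bigMax m λ l →
                  term v w i j k l

  fwCost : ∀ {m n} → (Fin n → Pt m) → Pt m → Carrier
  fwCost {m} {n} D x = bigSum n λ t → dtr x (D t)

  IsFermatWeber : ∀ {m n} → (Fin n → Pt m) → Pt m → Set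
  IsFermatWeber {m} D x = ∀ (y : Pt m) → fwCost D x ≤ fwCost D y

  tropComb : ∀ {m n} → (Fin n → Carrier) → (Fin n → Pt m) → Pt m
  tropComb {m} {n} a D i j = bigMax n λ t → a t + D t i j

  InTconv : ∀ {m n} → (Fin n → Pt m) → Pt m → Set
  InTconv {m} {n} D x = Σ (Fin n → Carrier) λ a → x ∼ tropComb a D

  MaxTwice : Carrier → Carrier → Carrier → Set
  MaxTwice a b c = (a ≡ b × c ≤ a) ⊎ (a ≡ c × b ≤ a) ⊎ (b ≡ c × a ≤ b)

  IsUltrametric : ∀ {m} → Pt m → Set
  IsUltrametric {m} x = ∀ (i j k : Fin m) → i < j → j < k → MaxTwice (x i j) (x i k) (x j k)

module Submission where

-- Tropical Fermat–Weber points of ultrametrics.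
--
-- For coefficients a let H(a) be the Fermat–Weber cost of the tropical
-- combination ⊕ₜ aₜ ⊙ D(t).  Every point y is beaten by such a combination:
-- with λₜ the minimum of y - D(t) over the coordinates, π = ⊕ₜ λₜ ⊙ D(t)
-- satisfies π ≤ y with equality at a minimising coordinate of each y - D(t),
-- which forces dtr(π, D(t)) ≤ dtr(y, D(t)).  Translating λ so that λ₀ = 0
-- moves π only along R·1 and puts λ in a fixed box.  H is bounded below and
-- uniformly continuous, so it attains its minimum a* on that box (extreme
-- value theorem, proved from the completeness axiom of the real field); hence
-- x* = ⊕ₜ a*ₜ ⊙ D(t) is a Fermat–Weber point lying in tconv(D), and it is an
-- ultrametric since tropical combinations of ultrametrics are ultrametrics.

open import Defs
open import Level using (0ℓ)
open import Data.Nat as ℕ using (ℕ; zero; suc; s≤s; z≤n)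
open import Data.Fin using (Fin)
import Data.Fin as Fin
open import Data.Product using (Σ; _×_; _,_; proj₁; proj₂)
open import Data.Sum using (_⊎_; inj₁; inj₂; [_,_]′)
open import Data.Empty using (⊥; ⊥-elim)
open import Relation.Nullary using (¬_; yes; no)
open import Relation.Nullary.Decidable using (toSum)
import Relation.Binary.PropositionalEquality as ≡
open ≡ using (_≡_)
open import Relation.Binary.Structures using (IsTotalOrder)
open import Relation.Binary.Bundles using (Poset)
open import Algebra.Bundles using (AbelianGroup; CommutativeRing)

-- A normaliser for abelian-group identities: an expression built from
-- variables, 0, + and - denotes an integer combination of its variables, and
-- expressions with the same coefficient vector are equal.  The coefficients
-- are computed by evaluation, so for closed expressions the normalised sides
-- are definitionally equal; Relation.Binary.Reflection then yields the
-- interface  solve n (λ x y → lhs ⊜ rhs) refl x y.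
module AbelianGroupSolver {c ℓ} (G : AbelianGroup c ℓ) where
  open AbelianGroup G renaming (_∙_ to _+_; ε to 0#; _⁻¹ to -_; ∙-cong to +-cong;
    ∙-congˡ to +-congˡ; ∙-congʳ to +-congʳ; identityˡ to +-identityˡ;
    identityʳ to +-identityʳ; inverseʳ to -‿inverseʳ; comm to +-comm)
  open import Data.Integer as ℤ using (ℤ; +_; -[1+_]; _⊖_)
  open import Data.Integer.Properties using ([1+m]⊖[1+n]≡m⊖n)
  open import Data.Nat.Properties using (+-suc)
  open import Data.Vec using (Vec; []; _∷_; zipWith; map; replicate; lookup)
  open import Algebra.Properties.AbelianGroup G using (⁻¹-∙-comm)
  open import Algebra.Properties.Group group using (ε⁻¹≈ε; ⁻¹-involutive)
  open import Algebra.Properties.CommutativeSemigroup commutativeSemigroup using (interchange)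
  open import Algebra.Definitions.RawMonoid rawMonoid using () renaming (_×_ to _×ₙ_)
  open import Algebra.Properties.Monoid.Mult monoid using (×-homo-+)
  open import Relation.Binary.Reasoning.Setoid setoid

  infixl 6 _⊕_
  infix 8 ⊝_

  data Expr (n : ℕ) : Set where
    var : Fin n → Expr n
    0ₑ : Expr n
    _⊕_ : Expr n → Expr n → Expr n
    ⊝_ : Expr n → Expr n

  ⟦_⟧ : ∀ {n} → Expr n → Vec Carrier n → Carrier
  ⟦ var i ⟧ ρ = lookup ρ i
  ⟦ 0ₑ ⟧ ρ = 0#
  ⟦ e ⊕ f ⟧ ρ = ⟦ e ⟧ ρ + ⟦ f ⟧ ρ
  ⟦ ⊝ e ⟧ ρ = - ⟦ e ⟧ ρ

  infixr 8 _·_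
  _·_ : ℤ → Carrier → Carrier
  (+ n) · x = n ×ₙ x
  -[1+ n ] · x = - (suc n ×ₙ x)

  cancel-common : ∀ x a b → (x + a) + - (x + b) ≈ a + - b
  cancel-common x a b = begin
    (x + a) + - (x + b)     ≈⟨ +-congˡ (sym (⁻¹-∙-comm x b)) ⟩
    (x + a) + (- x + - b)   ≈⟨ interchange x a (- x) (- b) ⟩
    (x + - x) + (a + - b)   ≈⟨ +-congʳ (-‿inverseʳ x) ⟩
    0# + (a + - b)          ≈⟨ +-identityˡ _ ⟩
    a + - b                 ∎

  ⊖-· : ∀ m n x → (m ⊖ n) · x ≈ m ×ₙ x + - (n ×ₙ x)
  ⊖-· m zero x = sym (trans (+-congˡ ε⁻¹≈ε) (+-identityʳ _))
  ⊖-· zero (suc n) x = sym (+-identityˡ _)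
  ⊖-· (suc m) (suc n) x = begin
    (suc m ⊖ suc n) · x             ≡⟨ ≡.cong (_· x) ([1+m]⊖[1+n]≡m⊖n m n) ⟩
    (m ⊖ n) · x                     ≈⟨ ⊖-· m n x ⟩
    m ×ₙ x + - (n ×ₙ x)             ≈⟨ cancel-common x _ _ ⟨
    suc m ×ₙ x + - (suc n ×ₙ x)     ∎

  ·-homo-+ : ∀ k l x → (k ℤ.+ l) · x ≈ k · x + l · x
  ·-homo-+ (+ m) (+ n) x = ×-homo-+ x m n
  ·-homo-+ (+ m) -[1+ n ] x = ⊖-· m (suc n) x
  ·-homo-+ -[1+ m ] (+ n) x = trans (⊖-· n (suc m) x) (+-comm _ _)
  ·-homo-+ -[1+ m ] -[1+ n ] x = begin
    - (suc (suc (m ℕ.+ n)) ×ₙ x)       ≡⟨ ≡.cong (λ k → - (suc k ×ₙ x)) (+-suc m n) ⟨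
    - ((suc m ℕ.+ suc n) ×ₙ x)         ≈⟨ ⁻¹-cong (×-homo-+ x (suc m) (suc n)) ⟩
    - (suc m ×ₙ x + suc n ×ₙ x)        ≈⟨ ⁻¹-∙-comm _ _ ⟨
    - (suc m ×ₙ x) + - (suc n ×ₙ x)    ∎

  ·-homo-neg : ∀ k x → (ℤ.- k) · x ≈ - (k · x)
  ·-homo-neg (+ zero) x = sym ε⁻¹≈ε
  ·-homo-neg (+ suc n) x = refl
  ·-homo-neg -[1+ n ] x = sym (⁻¹-involutive _)

  NF : ℕ → Set
  NF n = Vec ℤ n

  unit : ∀ {n} → Fin n → NF n
  unit Fin.zero = + 1 ∷ replicate _ (+ 0)
  unit (Fin.suc i) = + 0 ∷ unit i

  normalise : ∀ {n} → Expr n → NF n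
  normalise (var i) = unit i
  normalise 0ₑ = replicate _ (+ 0)
  normalise (e ⊕ f) = zipWith ℤ._+_ (normalise e) (normalise f)
  normalise (⊝ e) = map ℤ.-_ (normalise e)

  evalNF : ∀ {n} → NF n → Vec Carrier n → Carrier
  evalNF [] [] = 0#
  evalNF (k ∷ ks) (x ∷ xs) = k · x + evalNF ks xs

  ⟦_⇓⟧ : ∀ {n} → Expr n → Vec Carrier n → Carrier
  ⟦ e ⇓⟧ = evalNF (normalise e)

  evalNF-zero : ∀ {n} (ρ : Vec Carrier n) → evalNF (replicate n (+ 0)) ρ ≈ 0#
  evalNF-zero [] = refl
  evalNF-zero (x ∷ ρ) = trans (+-identityˡ _) (evalNF-zero ρ)

  evalNF-unit : ∀ {n} (i : Fin n) ρ → evalNF (unit i) ρ ≈ lookup ρ i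
  evalNF-unit Fin.zero (x ∷ ρ) = trans (+-cong (+-identityʳ x) (evalNF-zero ρ)) (+-identityʳ x)
  evalNF-unit (Fin.suc i) (x ∷ ρ) = trans (+-identityˡ _) (evalNF-unit i ρ)

  evalNF-+ : ∀ {n} (ks ls : NF n) ρ → evalNF (zipWith ℤ._+_ ks ls) ρ ≈ evalNF ks ρ + evalNF ls ρ
  evalNF-+ [] [] [] = sym (+-identityˡ 0#)
  evalNF-+ (k ∷ ks) (l ∷ ls) (x ∷ ρ) = begin
    (k ℤ.+ l) · x + evalNF (zipWith ℤ._+_ ks ls) ρ   ≈⟨ +-cong (·-homo-+ k l x) (evalNF-+ ks ls ρ) ⟩
    (k · x + l · x) + (evalNF ks ρ + evalNF ls ρ)     ≈⟨ interchange _ _ _ _ ⟩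
    (k · x + evalNF ks ρ) + (l · x + evalNF ls ρ)     ∎

  evalNF-neg : ∀ {n} (ks : NF n) ρ → evalNF (map ℤ.-_ ks) ρ ≈ - evalNF ks ρ
  evalNF-neg [] [] = sym ε⁻¹≈ε
  evalNF-neg (k ∷ ks) (x ∷ ρ) =
    trans (+-cong (·-homo-neg k x) (evalNF-neg ks ρ)) (⁻¹-∙-comm _ _)

  correct : ∀ {n} (e : Expr n) ρ → ⟦ e ⇓⟧ ρ ≈ ⟦ e ⟧ ρ
  correct (var i) ρ = evalNF-unit i ρ
  correct 0ₑ ρ = evalNF-zero ρ
  correct (e ⊕ f) ρ = trans (evalNF-+ (normalise e) (normalise f) ρ) (+-cong (correct e ρ) (correct f ρ))
  correct (⊝ e) ρ = trans (evalNF-neg (normalise e) ρ) (⁻¹-cong (correct e ρ))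

  open import Relation.Binary.Reflection setoid var ⟦_⟧ ⟦_⇓⟧ correct public
    using (solve; _⊜_)

module OrderedField (R : RealField) where
  open RealField R
  open Over R
  open ≡ using (refl; sym; trans; cong; cong₂; subst₂; module ≡-Reasoning)
  open IsTotalOrder isTotalOrder public using (total; antisym)
    renaming (refl to ≤-refl; trans to ≤-trans; reflexive to ≤-reflexive)

  commutativeRing : CommutativeRing 0ℓ 0ℓ
  commutativeRing = record { isCommutativeRing = isCommutativeRing }

  open CommutativeRing commutativeRing public
    using (+-abelianGroup; +-comm; +-identityˡ; +-identityʳ; -‿inverseʳ;
           *-identityˡ; *-identityʳ; distribˡ; distribʳ)
  open AbelianGroupSolver +-abelianGroup public using (solve; _⊜_; _⊕_; ⊝_; 0ₑ)
  open import Algebra.Properties.Ring (CommutativeRing.ring commutativeRing) using (-1*x≈-x)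
  open import Algebra.Properties.Group (CommutativeRing.+-group commutativeRing)
    using (ε⁻¹≈ε; ⁻¹-involutive)
  open ≡-Reasoning

  -0≡0 : - 0# ≡ 0#
  -0≡0 = ε⁻¹≈ε

  poset : Poset 0ℓ 0ℓ 0ℓ
  poset = record { isPartialOrder = IsTotalOrder.isPartialOrder isTotalOrder }

  infix 4 _<_
  _<_ : Carrier → Carrier → Set
  x < y = ¬ (y ≤ x)

  <⇒≤ : ∀ {x y} → x < y → x ≤ y
  <⇒≤ {x} {y} y≰x with total x y
  ... | inj₁ x≤y = x≤y
  ... | inj₂ y≤x = ⊥-elim (y≰x y≤x)

  +-monoʳ-≤ : ∀ {x y} z → x ≤ y → z + x ≤ z + y
  +-monoʳ-≤ {x} {y} z x≤y = subst₂ _≤_ (+-comm x z) (+-comm y z) (+-monoˡ-≤ z x≤y)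

  +-mono-≤ : ∀ {a b c d} → a ≤ b → c ≤ d → a + c ≤ b + d
  +-mono-≤ {b = b} {c} a≤b c≤d = ≤-trans (+-monoˡ-≤ c a≤b) (+-monoʳ-≤ b c≤d)

  ≤-translate : ∀ {a b a' b'} w → a ≤ b → a + w ≡ a' → b + w ≡ b' → a' ≤ b'
  ≤-translate w a≤b refl refl = +-monoˡ-≤ w a≤b

  +-cancelʳ-≤ : ∀ {a b} c → a + c ≤ b + c → a ≤ b
  +-cancelʳ-≤ {a} {b} c p = ≤-translate (- c) p
    (solve 2 (λ a c → a ⊕ c ⊕ ⊝ c ⊜ a) refl a c) (solve 2 (λ b c → b ⊕ c ⊕ ⊝ c ⊜ b) refl b c)

  neg-antitone : ∀ {a b} → a ≤ b → - b ≤ - a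
  neg-antitone {a} {b} a≤b = ≤-translate (- a + - b) a≤b
    (solve 2 (λ a b → a ⊕ (⊝ a ⊕ ⊝ b) ⊜ ⊝ b) refl a b) (solve 2 (λ a b → b ⊕ (⊝ a ⊕ ⊝ b) ⊜ ⊝ a) refl a b)

  x≤x+ε : ∀ {x ε} → 0# ≤ ε → x ≤ x + ε
  x≤x+ε {x} 0≤ε = subst₂ _≤_ (+-identityʳ x) refl (+-monoʳ-≤ x 0≤ε)

  x+ε≰x : ∀ {x ε} → 0# < ε → ¬ (x + ε ≤ x)
  x+ε≰x {x} {ε} 0<ε x+ε≤x = 0<ε (≤-translate (- x) x+ε≤x
    (solve 2 (λ x ε → x ⊕ ε ⊕ ⊝ x ⊜ ε) refl x ε) (-‿inverseʳ x))

  x≰x-ε : ∀ {x ε} → 0# < ε → ¬ (x ≤ x - ε)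
  x≰x-ε {x} {ε} 0<ε x≤x-ε =
    x+ε≰x 0<ε (≤-translate ε x≤x-ε refl (solve 2 (λ x ε → x ⊕ ⊝ ε ⊕ ε ⊜ x) refl x ε))

  0≤1 : 0# ≤ 1#
  0≤1 with total 0# 1#
  ... | inj₁ 0≤1 = 0≤1
  ... | inj₂ 1≤0 = ⊥-elim (0≢1 (antisym (subst₂ _≤_ refl square (*-nonneg 0≤-1 0≤-1)) 1≤0))
    where
    0≤-1 : 0# ≤ - 1#
    0≤-1 = subst₂ _≤_ -0≡0 refl (neg-antitone 1≤0)
    square : - 1# * - 1# ≡ 1#
    square = trans (-1*x≈-x (- 1#)) (⁻¹-involutive 1#)

  1+1≢0 : ¬ (1# + 1# ≡ 0#)
  1+1≢0 2≡0 = 0≢1 (antisym 0≤1 (subst₂ _≤_ (sym 1≡-1) -0≡0 (neg-antitone 0≤1)))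
    where
    1≡-1 : 1# ≡ - 1#
    1≡-1 = begin
      1#                  ≡⟨ solve 1 (λ x → x ⊜ x ⊕ x ⊕ ⊝ x) refl 1# ⟩
      (1# + 1#) + - 1#    ≡⟨ cong (_+ - 1#) 2≡0 ⟩
      0# + - 1#           ≡⟨ +-identityˡ (- 1#) ⟩
      - 1#                ∎

  half : ∀ x → Σ Carrier λ h → h + h ≡ x
  half x with inverse (1# + 1#) 1+1≢0
  ... | i , 2i≡1 = x * i , (begin
    x * i + x * i              ≡⟨ distribˡ x i i ⟨
    x * (i + i)                ≡⟨ cong (x *_) (cong₂ _+_ (*-identityˡ i) (*-identityˡ i)) ⟨
    x * (1# * i + 1# * i)      ≡⟨ cong (x *_) (distribʳ i 1# 1#) ⟨
    x * ((1# + 1#) * i)        ≡⟨ cong (x *_) 2i≡1 ⟩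
    x * 1#                     ≡⟨ *-identityʳ x ⟩
    x                          ∎)

  half-pos : ∀ {x h} → h + h ≡ x → 0# < x → 0# < h
  half-pos {x} {h} h+h≡x 0<x h≤0 = 0<x (subst₂ _≤_ h+h≡x (+-identityˡ 0#) (+-mono-≤ h≤0 h≤0))

  ≤-by-pos : ∀ {x y} → (∀ δ → 0# < δ → x ≤ y + δ) → x ≤ y
  ≤-by-pos {x} {y} close with x ≤? y
  ... | yes x≤y = x≤y
  ... | no x≰y = ⊥-elim (0<δ (+-cancelʳ-≤ δ (subst₂ _≤_ (sym 2δ≡x-y) (sym (+-identityˡ δ)) x-y≤δ)))
    where
    δ : Carrier
    δ = proj₁ (half (x - y))
    2δ≡x-y : δ + δ ≡ x - y
    2δ≡x-y = proj₂ (half (x - y))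
    0<δ : 0# < δ
    0<δ = half-pos 2δ≡x-y λ x-y≤0 → x≰y (≤-translate y x-y≤0
      (solve 2 (λ x y → x ⊕ ⊝ y ⊕ y ⊜ x) refl x y) (+-identityˡ y))
    x-y≤δ : x - y ≤ δ
    x-y≤δ = ≤-translate (- y) (close δ 0<δ) refl (solve 2 (λ y δ → y ⊕ δ ⊕ ⊝ y ⊜ δ) refl y δ)

  max-ubˡ : ∀ x y → x ≤ max x y
  max-ubˡ x y with x ≤? y
  ... | yes x≤y = x≤y
  ... | no _ = ≤-refl

  max-ubʳ : ∀ x y → y ≤ max x y
  max-ubʳ x y with x ≤? y
  ... | yes _ = ≤-refl
  ... | no x≰y = <⇒≤ x≰y

  max-lub : ∀ {x y z} → x ≤ z → y ≤ z → max x y ≤ z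
  max-lub {x} {y} x≤z y≤z with x ≤? y
  ... | yes _ = y≤z
  ... | no _ = x≤z

  ≤-max-split : ∀ {x y z} → z ≤ max x y → z ≤ x ⊎ z ≤ y
  ≤-max-split {x} {y} z≤max with x ≤? y
  ... | yes _ = inj₂ z≤max
  ... | no _ = inj₁ z≤max

  ∣∣-ub : ∀ x → x ≤ ∣ x ∣
  ∣∣-ub x = max-ubˡ x (- x)

  ∣∣-ub-neg : ∀ x → - x ≤ ∣ x ∣
  ∣∣-ub-neg x = max-ubʳ x (- x)

  ∣∣-nonneg : ∀ x → 0# ≤ ∣ x ∣
  ∣∣-nonneg x with total 0# x
  ... | inj₁ 0≤x = ≤-trans 0≤x (∣∣-ub x)
  ... | inj₂ x≤0 = ≤-trans (subst₂ _≤_ -0≡0 refl (neg-antitone x≤0)) (∣∣-ub-neg x)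

  -∣∣≤ : ∀ x → - ∣ x ∣ ≤ x
  -∣∣≤ x = subst₂ _≤_ refl (⁻¹-involutive x) (neg-antitone (∣∣-ub-neg x))

  bigMax-ub : ∀ k (f : Fin k → Carrier) i → f i ≤ bigMax k f
  bigMax-ub (suc zero) f Fin.zero = ≤-refl
  bigMax-ub (suc (suc k)) f Fin.zero = max-ubˡ _ _
  bigMax-ub (suc (suc k)) f (Fin.suc i) = ≤-trans (bigMax-ub (suc k) (λ j → f (Fin.suc j)) i) (max-ubʳ _ _)

  bigMax-lub : ∀ k (f : Fin (suc k) → Carrier) {b} → (∀ i → f i ≤ b) → bigMax (suc k) f ≤ b
  bigMax-lub zero f f≤b = f≤b Fin.zero
  bigMax-lub (suc k) f f≤b = max-lub (f≤b Fin.zero) (bigMax-lub k _ (λ i → f≤b (Fin.suc i)))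

  bigSum-mono : ∀ k {f g : Fin k → Carrier} → (∀ i → f i ≤ g i) → bigSum k f ≤ bigSum k g
  bigSum-mono zero f≤g = ≤-refl
  bigSum-mono (suc k) f≤g = +-mono-≤ (f≤g Fin.zero) (bigSum-mono k (λ i → f≤g (Fin.suc i)))

  bigSum-nonneg : ∀ k {f : Fin k → Carrier} → (∀ i → 0# ≤ f i) → 0# ≤ bigSum k f
  bigSum-nonneg zero _ = ≤-refl
  bigSum-nonneg (suc k) 0≤f =
    subst₂ _≤_ (+-identityˡ 0#) refl (+-mono-≤ (0≤f Fin.zero) (bigSum-nonneg k (λ i → 0≤f (Fin.suc i))))

  argmin : ∀ k (f : Fin (suc k) → Carrier) → Σ (Fin (suc k)) λ i → ∀ j → f i ≤ f j
  argmin zero f = Fin.zero , λ { Fin.zero → ≤-refl }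
  argmin (suc k) f with argmin k (λ j → f (Fin.suc j))
  ... | i , i-min with f Fin.zero ≤? f (Fin.suc i)
  ...   | yes f0≤fi = Fin.zero , λ { Fin.zero → ≤-refl ; (Fin.suc j) → ≤-trans f0≤fi (i-min j) }
  ...   | no f0≰fi = Fin.suc i , λ { Fin.zero → <⇒≤ f0≰fi ; (Fin.suc j) → i-min j }

-- The interval case is proved with the
-- completeness axiom; the box case follows by minimising fibrewise.
module ExtremeValue (R : RealField) where
  open RealField R
  open Over R
  open OrderedField R
  open ≡ using (refl; sym; trans; cong; subst₂)
  open import Data.Vec.Functional using (_∷_)

  Near : Carrier → Carrier → Carrier → Set
  Near ε s t = s ≤ t + ε × t ≤ s + ε

  Close : ∀ {k} → Carrier → (Fin k → Carrier) → (Fin k → Carrier) → Set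
  Close ε a b = ∀ i → Near ε (a i) (b i)

  Modulus₁ : (Carrier → Carrier) → Carrier → Set
  Modulus₁ G δ = Σ Carrier λ ε → 0# < ε × (∀ s t → Near ε s t → G s ≤ G t + δ)

  Modulus : ∀ k → ((Fin k → Carrier) → Carrier) → Carrier → Set
  Modulus k g δ = Σ Carrier λ ε → 0# < ε × (∀ a b → Close ε a b → g a ≤ g b + δ)

  UniformlyContinuous₁ : (Carrier → Carrier) → Set
  UniformlyContinuous₁ G = ∀ δ → 0# < δ → Modulus₁ G δ

  UniformlyContinuous : ∀ k → ((Fin k → Carrier) → Carrier) → Set
  UniformlyContinuous k g = ∀ δ → 0# < δ → Modulus k g δ

  Supremum : (Carrier → Set) → Set
  Supremum P = Σ Carrier λ s → (∀ x → P x → x ≤ s) × (∀ u → (∀ x → P x → x ≤ u) → s ≤ u)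

  In : Carrier → Carrier → Carrier → Set
  In lo hi s = lo ≤ s × s ≤ hi

  InBox : ∀ {k} → Carrier → Carrier → (Fin k → Carrier) → Set
  InBox lo hi a = ∀ i → In lo hi (a i)

  near-refl : ∀ {ε} s → 0# ≤ ε → Near ε s s
  near-refl s 0≤ε = x≤x+ε 0≤ε , x≤x+ε 0≤ε

  uc-pointwise : ∀ {k g} → UniformlyContinuous k g → ∀ {a b} → (∀ i → a i ≡ b i) → g a ≤ g b
  uc-pointwise uc {a} a≗b = ≤-by-pos λ δ 0<δ →
    let (ε , 0<ε , close⇒) = uc δ 0<δ
    in close⇒ _ _ λ i → subst₂ (Near ε) refl (a≗b i) (near-refl (a i) (<⇒≤ 0<ε))

  module MinimumOnInterval (lo hi : Carrier) (lo≤hi : lo ≤ hi) (G : Carrier → Carrier)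
                           (b : Carrier) (b≤G : ∀ s → b ≤ G s) (ucG : UniformlyContinuous₁ G) where

    LowerBoundFrom : Carrier → Carrier → Set
    LowerBoundFrom t L = ∀ s → In t hi s → L ≤ G s

    -- c, the infimum of G on [lo, hi], is the supremum of its lower bounds
    infimum : Supremum (LowerBoundFrom lo)
    infimum = supremum (LowerBoundFrom lo) (b , λ s _ → b≤G s)
                       (G lo , λ L lb → lb lo (≤-refl , lo≤hi))
    c : Carrier
    c = proj₁ infimum

    c-greatest : ∀ L → LowerBoundFrom lo L → L ≤ c
    c-greatest = proj₁ (proj₂ infimum)

    c-lower : ∀ s → In lo hi s → c ≤ G s
    c-lower s s∈I = proj₂ (proj₂ infimum) (G s) λ L lb → lb s s∈I

    -- t ∈ [lo, hi] and G still gets arbitrarily close to c on [t, hi]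
    TailInf : Carrier → Set
    TailInf t = In lo hi t × (∀ L → LowerBoundFrom t L → L ≤ c)

    -- s* is the supremum of TailInf; it will be the minimiser
    tailSup : Supremum TailInf
    tailSup = supremum TailInf (lo , (≤-refl , lo≤hi) , c-greatest) (hi , λ t t∈ → proj₂ (proj₁ t∈))
    s* : Carrier
    s* = proj₁ tailSup

    s*-ub : ∀ t → TailInf t → t ≤ s*
    s*-ub = proj₁ (proj₂ tailSup)

    s*-least : ∀ u → (∀ t → TailInf t → t ≤ u) → s* ≤ u
    s*-least = proj₂ (proj₂ tailSup)

    s*∈I : In lo hi s*
    s*∈I = s*-ub lo ((≤-refl , lo≤hi) , c-greatest) , s*-least hi (λ t t∈ → proj₂ (proj₁ t∈))

    glue : ∀ {t u L M} → (∀ s → t ≤ s → s ≤ u → M ≤ G s) → LowerBoundFrom u L → L ≤ M →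
           LowerBoundFrom t L
    glue {u = u} nearby beyond L≤M s (t≤s , s≤hi) with s ≤? u
    ... | yes s≤u = ≤-trans L≤M (nearby s t≤s s≤u)
    ... | no s≰u = beyond s (<⇒≤ s≰u , s≤hi)

    -- if G s* were above c, a neighbourhood of s* would lie above c and
    -- s* could be pushed further right
    module AboveInfimum (c<Gs* : c < G s*) where
      δ : Carrier
      δ = proj₁ (half (G s* - c))
      0<δ : 0# < δ
      0<δ = half-pos (proj₂ (half (G s* - c))) λ Gs*-c≤0 →
        c<Gs* (≤-translate c Gs*-c≤0 (solve 2 (λ g c → g ⊕ ⊝ c ⊕ c ⊜ g) refl (G s*) c) (+-identityˡ c))

      ε : Carrier
      ε = proj₁ (ucG δ 0<δ)
      0<ε : 0# < ε
      0<ε = proj₁ (proj₂ (ucG δ 0<δ))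

      above : ∀ s → s* - ε ≤ s → s ≤ s* + ε → c + δ ≤ G s
      above s s*-ε≤s s≤s*+ε = +-cancelʳ-≤ δ (subst₂ _≤_ Gs*≡ refl
        (proj₂ (proj₂ (ucG δ 0<δ)) s* s (s*≤s+ε , s≤s*+ε)))
        where
        s*≤s+ε : s* ≤ s + ε
        s*≤s+ε = ≤-translate ε s*-ε≤s (solve 2 (λ x e → x ⊕ ⊝ e ⊕ e ⊜ x) refl s* ε) refl
        Gs*≡ : G s* ≡ c + δ + δ
        Gs*≡ = trans (solve 2 (λ g c → g ⊜ c ⊕ (g ⊕ ⊝ c)) refl (G s*) c)
                     (trans (cong (c +_) (sym (proj₂ (half (G s* - c))))) (solve 2 (λ c d → c ⊕ (d ⊕ d) ⊜ c ⊕ d ⊕ d) refl c δ))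

      c+δ≰c : ¬ (c + δ ≤ c)
      c+δ≰c = x+ε≰x 0<δ

      persists : ∀ {t u L} → TailInf t → s* - ε ≤ t → u ≤ s* + ε → LowerBoundFrom u L → L ≤ c
      persists {t} {u} {L} (_ , inf-t) s*-ε≤t u≤s*+ε lb =
        [ (λ L≤c+δ → inf-t L (glue nearby lb L≤c+δ))
        , (λ L≰c+δ → ⊥-elim (c+δ≰c (inf-t (c + δ) (glue nearby (λ s s∈ → ≤-trans (<⇒≤ L≰c+δ) (lb s s∈)) ≤-refl))))
        ]′ (toSum (L ≤? (c + δ)))
        where
        nearby : ∀ s → t ≤ s → s ≤ u → c + δ ≤ G s
        nearby s t≤s s≤u = above s (≤-trans s*-ε≤t t≤s) (≤-trans s≤u u≤s*+ε)

      tailInf-left : ∀ t → TailInf t → t ≤ s* - ε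
      tailInf-left t t∈ = [ (λ t≤ → t≤) , (λ t≰ → ⊥-elim (beyond (<⇒≤ t≰))) ]′ (toSum (t ≤? (s* - ε)))
        where
        beyond : s* - ε ≤ t → ⊥
        beyond s*-ε≤t = [ inside , outside ]′ (toSum ((s* + ε) ≤? hi))
          where
          inside : s* + ε ≤ hi → ⊥
          inside s*+ε≤hi = x+ε≰x 0<ε (s*-ub (s* + ε)
            ((≤-trans (proj₁ s*∈I) (x≤x+ε (<⇒≤ 0<ε)) , s*+ε≤hi) , λ L lb → persists t∈ s*-ε≤t ≤-refl lb))
          outside : ¬ (s* + ε ≤ hi) → ⊥
          outside s*+ε≰hi = c+δ≰c (persists t∈ s*-ε≤t (<⇒≤ s*+ε≰hi) atHi)
            where
            atHi : LowerBoundFrom hi (c + δ)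
            atHi s (hi≤s , s≤hi) = above s (≤-trans s*-ε≤t (≤-trans (proj₂ (proj₁ t∈)) hi≤s))
                                           (≤-trans s≤hi (<⇒≤ s*+ε≰hi))

      absurd : ⊥
      absurd = x≰x-ε 0<ε (s*-least (s* - ε) tailInf-left)

    Gs*≤c : G s* ≤ c
    Gs*≤c with G s* ≤? c
    ... | yes Gs*≤c = Gs*≤c
    ... | no c<Gs* = ⊥-elim (AboveInfimum.absurd c<Gs*)

    minimum : Σ Carrier λ t → In lo hi t × (∀ s → In lo hi s → G t ≤ G s)
    minimum = s* , s*∈I , λ s s∈I → ≤-trans Gs*≤c (c-lower s s∈I)

  -- Box version, by induction on the dimension: minimise each fibre
  -- t ∷ (·) recursively, then minimise the fibre minima over t ∈ [lo, hi].
  minimumOnBox : ∀ k lo hi → lo ≤ hi → (g : (Fin k → Carrier) → Carrier) →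
                 (b : Carrier) → (∀ a → b ≤ g a) → UniformlyContinuous k g →
                 Σ (Fin k → Carrier) λ a* → InBox lo hi a* × (∀ a → InBox lo hi a → g a* ≤ g a)
  minimumOnBox zero lo hi lo≤hi g b b≤g ucg = (λ ()) , (λ ()) , λ a _ → uc-pointwise ucg (λ ())
  minimumOnBox (suc k) lo hi lo≤hi g b b≤g ucg = a* , a*∈ , a*-min
    where
    fibre : Carrier → (Fin k → Carrier) → Carrier
    fibre t a = g (t ∷ a)

    uc-fibre : ∀ t → UniformlyContinuous k (fibre t)
    uc-fibre t δ 0<δ =
      let (ε , 0<ε , close⇒) = ucg δ 0<δ
      in ε , 0<ε , λ a a' close → close⇒ (t ∷ a) (t ∷ a') λ
           { Fin.zero → near-refl t (<⇒≤ 0<ε) ; (Fin.suc i) → close i }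

    fibreMin : ∀ t → Σ (Fin k → Carrier) λ a* → InBox lo hi a* × (∀ a → InBox lo hi a → fibre t a* ≤ fibre t a)
    fibreMin t = minimumOnBox k lo hi lo≤hi (fibre t) b (λ a → b≤g (t ∷ a)) (uc-fibre t)

    A : Carrier → Fin k → Carrier
    A t = proj₁ (fibreMin t)

    G : Carrier → Carrier
    G t = fibre t (A t)

    ucG : UniformlyContinuous₁ G
    ucG δ 0<δ =
      let (ε , 0<ε , close⇒) = ucg δ 0<δ
      in ε , 0<ε , λ s t s~t → ≤-trans (proj₂ (proj₂ (fibreMin s)) (A t) (proj₁ (proj₂ (fibreMin t))))
           (close⇒ (s ∷ A t) (t ∷ A t) λ { Fin.zero → s~t ; (Fin.suc i) → near-refl (A t i) (<⇒≤ 0<ε) })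

    open MinimumOnInterval lo hi lo≤hi G b (λ t → b≤g (t ∷ A t)) ucG using (minimum)

    t* : Carrier
    t* = proj₁ minimum

    a* : Fin (suc k) → Carrier
    a* = t* ∷ A t*

    a*∈ : InBox lo hi a*
    a*∈ Fin.zero = proj₁ (proj₂ minimum)
    a*∈ (Fin.suc i) = proj₁ (proj₂ (fibreMin t*)) i

    a*-min : ∀ a → InBox lo hi a → g a* ≤ g a
    a*-min a a∈ = ≤-trans (proj₂ (proj₂ minimum) (a Fin.zero) (a∈ Fin.zero))
      (≤-trans (proj₂ (proj₂ (fibreMin (a Fin.zero))) (λ i → a (Fin.suc i)) (λ i → a∈ (Fin.suc i)))
               (uc-pointwise ucg λ { Fin.zero → refl ; (Fin.suc i) → refl }))

  refine : ∀ {ε₁ ε₂} → 0# < ε₁ → 0# < ε₂ → Σ Carrier λ ε → 0# < ε × ε ≤ ε₁ × ε ≤ ε₂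
  refine {ε₁} {ε₂} 0<ε₁ 0<ε₂ =
    [ (λ ε₁≤ε₂ → ε₁ , 0<ε₁ , ≤-refl , ε₁≤ε₂) , (λ ε₁≰ε₂ → ε₂ , 0<ε₂ , <⇒≤ ε₁≰ε₂ , ≤-refl) ]′
      (toSum (ε₁ ≤? ε₂))

  close-mono : ∀ {k ε ε'} {a b : Fin k → Carrier} → ε' ≤ ε → Close ε' a b → Close ε a b
  close-mono ε'≤ε close i =
    ≤-trans (proj₁ (close i)) (+-monoʳ-≤ _ ε'≤ε) , ≤-trans (proj₂ (close i)) (+-monoʳ-≤ _ ε'≤ε)

  uc-bigSum : ∀ n {k} (f : Fin n → (Fin k → Carrier) → Carrier) → (∀ t → UniformlyContinuous k (f t)) →
              UniformlyContinuous k (λ a → bigSum n (λ t → f t a))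
  uc-bigSum zero f uc δ 0<δ = δ , 0<δ , λ a b _ → x≤x+ε (<⇒≤ 0<δ)
  uc-bigSum (suc n) f uc δ 0<δ = ε , 0<ε , sum-close
    where
    h : Carrier
    h = proj₁ (half δ)
    0<h : 0# < h
    0<h = half-pos (proj₂ (half δ)) 0<δ
    head-uc : Modulus _ (f Fin.zero) h
    head-uc = uc Fin.zero h 0<h
    tail-uc : Modulus _ (λ a → bigSum n (λ t → f (Fin.suc t) a)) h
    tail-uc = uc-bigSum n (λ t → f (Fin.suc t)) (λ t → uc (Fin.suc t)) h 0<h
    common : Σ Carrier λ ε → 0# < ε × ε ≤ proj₁ head-uc × ε ≤ proj₁ tail-uc
    common = refine (proj₁ (proj₂ head-uc)) (proj₁ (proj₂ tail-uc))
    ε : Carrier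
    ε = proj₁ common
    0<ε : 0# < ε
    0<ε = proj₁ (proj₂ common)
    sum-close : ∀ a b → Close ε a b → bigSum (suc n) (λ t → f t a) ≤ bigSum (suc n) (λ t → f t b) + δ
    sum-close a b close = subst₂ _≤_ refl regroup (+-mono-≤
      (proj₂ (proj₂ head-uc) a b (close-mono (proj₁ (proj₂ (proj₂ common))) close))
      (proj₂ (proj₂ tail-uc) a b (close-mono (proj₂ (proj₂ (proj₂ common))) close)))
      where
      regroup : f Fin.zero b + h + (bigSum n (λ t → f (Fin.suc t) b) + h) ≡ bigSum (suc n) (λ t → f t b) + δ
      regroup = trans (solve 3 (λ x y h → x ⊕ h ⊕ (y ⊕ h) ⊜ x ⊕ y ⊕ (h ⊕ h)) refl _ _ h)
                      (cong (bigSum (suc n) (λ t → f t b) +_) (proj₂ (half δ)))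

module Tropical (R : RealField) where
  open RealField R
  open Over R
  open OrderedField R
  open ≡ using (refl; sym; subst₂)

  -- the quantity (v_p - w_p) - (v_q - w_q), for p = {i,j} and q = {k,l},
  -- in the shape used by the definition of term
  gap : ∀ {m} → Pt m → Pt m → Fin m → Fin m → Fin m → Fin m → Carrier
  gap v w i j k l = ((v i j - w i j) - v k l) + w k l

  gap-swap : ∀ {m} (v w : Pt m) i j k l → - gap v w i j k l ≡ gap v w k l i j
  gap-swap v w i j k l =
    solve 4 (λ a b c d → ⊝ (a ⊕ ⊝ b ⊕ ⊝ c ⊕ d) ⊜ c ⊕ ⊝ d ⊕ ⊝ a ⊕ b) refl (v i j) (w i j) (v k l) (w k l)

  term-coord : ∀ {m} (v w : Pt m) i j k l → i Fin.< j → k Fin.< l → term v w i j k l ≡ ∣ gap v w i j k l ∣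
  term-coord v w i j k l i<j k<l with i Fin.<? j | k Fin.<? l
  ... | yes _ | yes _ = refl
  ... | no i≮j | _ = ⊥-elim (i≮j i<j)
  ... | yes _ | no k≮l = ⊥-elim (k≮l k<l)

  term-le : ∀ {m} (v w : Pt m) i j k l {B} → 0# ≤ B →
            (i Fin.< j → k Fin.< l → ∣ gap v w i j k l ∣ ≤ B) → term v w i j k l ≤ B
  term-le v w i j k l 0≤B bound with i Fin.<? j | k Fin.<? l
  ... | yes i<j | yes k<l = bound i<j k<l
  ... | no _ | _ = 0≤B
  ... | yes _ | no _ = 0≤B

  term-nonneg : ∀ {m} (v w : Pt m) i j k l → 0# ≤ term v w i j k l
  term-nonneg v w i j k l with i Fin.<? j | k Fin.<? l
  ... | yes _ | yes _ = ∣∣-nonneg _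
  ... | no _ | _ = ≤-refl
  ... | yes _ | no _ = ≤-refl

  term≤dtr : ∀ {m} (v w : Pt m) i j k l → term v w i j k l ≤ dtr v w
  term≤dtr {m} v w i j k l =
    ≤-trans (bigMax-ub m _ l) (≤-trans (bigMax-ub m _ k) (≤-trans (bigMax-ub m _ j) (bigMax-ub m _ i)))

  gap≤dtr : ∀ {m} (v w : Pt m) i j k l → i Fin.< j → k Fin.< l → gap v w i j k l ≤ dtr v w
  gap≤dtr v w i j k l i<j k<l =
    ≤-trans (∣∣-ub _) (subst₂ _≤_ (term-coord v w i j k l i<j k<l) refl (term≤dtr v w i j k l))

  dtr-nonneg : ∀ {m} (v w : Pt (suc m)) → 0# ≤ dtr v w
  dtr-nonneg {m} v w = ≤-trans (term-nonneg v w z z z z) (term≤dtr v w z z z z)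
    where
    z : Fin (suc m)
    z = Fin.zero

  -- since gap is antisymmetric in p and q, one-sided bounds on gaps bound dtr
  dtr-lub : ∀ {m} (v w : Pt (suc m)) {B} → 0# ≤ B →
            (∀ i j k l → i Fin.< j → k Fin.< l → gap v w i j k l ≤ B) → dtr v w ≤ B
  dtr-lub {m} v w 0≤B bound =
    bigMax-lub m _ λ i → bigMax-lub m _ λ j → bigMax-lub m _ λ k → bigMax-lub m _ λ l →
      term-le v w i j k l 0≤B λ i<j k<l →
        max-lub (bound i j k l i<j k<l)
                (subst₂ _≤_ (sym (gap-swap v w i j k l)) refl (bound k l i j k<l i<j))

  dtr-perturb : ∀ {m} (x x' w : Pt (suc m)) c₁ c₂ → 0# ≤ c₁ + c₂ →
                (∀ i j → i Fin.< j → x i j ≤ x' i j + c₁) →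
                (∀ i j → i Fin.< j → x' i j ≤ x i j + c₂) →
                dtr x w ≤ dtr x' w + (c₁ + c₂)
  dtr-perturb x x' w c₁ c₂ 0≤c x≤x'+c₁ x'≤x+c₂ =
    dtr-lub x w (subst₂ _≤_ (+-identityˡ 0#) refl (+-mono-≤ (dtr-nonneg x' w) 0≤c))
      λ i j k l i<j k<l → ≤-trans (gap-perturb (x≤x'+c₁ i j i<j) (x'≤x+c₂ k l k<l))
                                  (+-monoˡ-≤ (c₁ + c₂) (gap≤dtr x' w i j k l i<j k<l))
    where
    gap-perturb : ∀ {a a' b b' wp wq} → a ≤ a' + c₁ → b' ≤ b + c₂ →
                  ((a - wp) - b) + wq ≤ (((a' - wp) - b') + wq) + (c₁ + c₂)
    gap-perturb {a} {a'} {b} {b'} {wp} {wq} p q = ≤-translate ((- wp + - b) + (- b' + wq)) (+-mono-≤ p q)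
      (solve 5 (λ a b b' wp wq → a ⊕ b' ⊕ (⊝ wp ⊕ ⊝ b ⊕ (⊝ b' ⊕ wq)) ⊜ a ⊕ ⊝ wp ⊕ ⊝ b ⊕ wq)
         refl a b b' wp wq)
      (solve 7 (λ a' b b' wp wq c₁ c₂ → a' ⊕ c₁ ⊕ (b ⊕ c₂) ⊕ (⊝ wp ⊕ ⊝ b ⊕ (⊝ b' ⊕ wq))
                                        ⊜ a' ⊕ ⊝ wp ⊕ ⊝ b' ⊕ wq ⊕ (c₁ ⊕ c₂))
         refl a' b b' wp wq c₁ c₂)

  dtr-projection : ∀ {m} (z y w : Pt (suc m)) → (∀ i j → i Fin.< j → z i j ≤ y i j) →
                   ∀ i₀ j₀ → i₀ Fin.< j₀ → (∀ i j → i Fin.< j → y i₀ j₀ - w i₀ j₀ ≤ z i j - w i j) →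
                   dtr z w ≤ dtr y w
  dtr-projection z y w z≤y i₀ j₀ i₀<j₀ min₀ =
    dtr-lub z w (dtr-nonneg y w) λ i j k l i<j k<l →
      ≤-trans (gap-project (z≤y i j i<j) (min₀ k l k<l)) (gap≤dtr y w i j i₀ j₀ i<j i₀<j₀)
    where
    gap-project : ∀ {a a' b r wp wq wr} → a ≤ a' → r - wr ≤ b - wq →
                  ((a - wp) - b) + wq ≤ ((a' - wp) - r) + wr
    gap-project {a} {a'} {b} {r} {wp} {wq} {wr} p q =
      ≤-translate ((- wp + - b + wq) + (- r + wr)) (+-mono-≤ p q)
        (solve 6 (λ a b r wp wq wr → a ⊕ (r ⊕ ⊝ wr) ⊕ (⊝ wp ⊕ ⊝ b ⊕ wq ⊕ (⊝ r ⊕ wr)) ⊜ a ⊕ ⊝ wp ⊕ ⊝ b ⊕ wq)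
           refl a b r wp wq wr)
        (solve 6 (λ a' b r wp wq wr → a' ⊕ (b ⊕ ⊝ wq) ⊕ (⊝ wp ⊕ ⊝ b ⊕ wq ⊕ (⊝ r ⊕ wr)) ⊜ a' ⊕ ⊝ wp ⊕ ⊝ r ⊕ wr)
           refl a' b r wp wq wr)

  tropComb-ub : ∀ {m n} (a : Fin n → Carrier) (D : Fin n → Pt m) t i j → a t + D t i j ≤ tropComb a D i j
  tropComb-ub {n = n} a D t i j = bigMax-ub n (λ s → a s + D s i j) t

  tropComb-lub : ∀ {m n} (a : Fin (suc n) → Carrier) (D : Fin (suc n) → Pt m) i j {B} →
                 (∀ t → a t + D t i j ≤ B) → tropComb a D i j ≤ B
  tropComb-lub {n = n} a D i j = bigMax-lub n (λ s → a s + D s i j)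

  tropComb-shift : ∀ {m n} (a b : Fin (suc n) → Carrier) (D : Fin (suc n) → Pt m) c →
                   (∀ t → a t ≤ b t + c) → ∀ i j → tropComb a D i j ≤ tropComb b D i j + c
  tropComb-shift a b D c a≤b+c i j = tropComb-lub a D i j λ t →
    ≤-trans (≤-translate (D t i j) (a≤b+c t) refl
              (solve 3 (λ b c d → b ⊕ c ⊕ d ⊜ b ⊕ d ⊕ c) refl (b t) c (D t i j)))
            (+-monoˡ-≤ c (tropComb-ub b D t i j))

  maxTwice⇒ : ∀ {a b c} → MaxTwice a b c → a ≤ max b c × b ≤ max a c × c ≤ max a b
  maxTwice⇒ {a} {b} {c} (inj₁ (a≡b , c≤a)) =
    ≤-trans (≤-reflexive a≡b) (max-ubˡ b c) , ≤-trans (≤-reflexive (sym a≡b)) (max-ubˡ a c) , ≤-trans c≤a (max-ubˡ a b)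
  maxTwice⇒ {a} {b} {c} (inj₂ (inj₁ (a≡c , b≤a))) =
    ≤-trans (≤-reflexive a≡c) (max-ubʳ b c) , ≤-trans b≤a (max-ubˡ a c) , ≤-trans (≤-reflexive (sym a≡c)) (max-ubˡ a b)
  maxTwice⇒ {a} {b} {c} (inj₂ (inj₂ (b≡c , a≤b))) =
    ≤-trans a≤b (max-ubˡ b c) , ≤-trans (≤-reflexive b≡c) (max-ubʳ a c) , ≤-trans (≤-reflexive (sym b≡c)) (max-ubʳ a b)

  ⇒maxTwice : ∀ {a b c} → a ≤ max b c → b ≤ max a c → c ≤ max a b → MaxTwice a b c
  ⇒maxTwice p q r = cases (≤-max-split p) (≤-max-split q) (≤-max-split r)
    where
    cases : ∀ {a b c} → a ≤ b ⊎ a ≤ c → b ≤ a ⊎ b ≤ c → c ≤ a ⊎ c ≤ b → MaxTwice a b c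
    cases (inj₁ a≤b) (inj₁ b≤a) (inj₁ c≤a) = inj₁ (antisym a≤b b≤a , c≤a)
    cases (inj₁ a≤b) (inj₁ b≤a) (inj₂ c≤b) = inj₁ (antisym a≤b b≤a , ≤-trans c≤b b≤a)
    cases (inj₁ a≤b) (inj₂ b≤c) (inj₁ c≤a) = inj₁ (antisym a≤b (≤-trans b≤c c≤a) , c≤a)
    cases (inj₁ a≤b) (inj₂ b≤c) (inj₂ c≤b) = inj₂ (inj₂ (antisym b≤c c≤b , a≤b))
    cases (inj₂ a≤c) (inj₁ b≤a) (inj₁ c≤a) = inj₂ (inj₁ (antisym a≤c c≤a , b≤a))
    cases (inj₂ a≤c) (inj₁ b≤a) (inj₂ c≤b) = inj₂ (inj₁ (antisym a≤c (≤-trans c≤b b≤a) , b≤a))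
    cases (inj₂ a≤c) (inj₂ b≤c) (inj₁ c≤a) = inj₂ (inj₁ (antisym a≤c c≤a , ≤-trans b≤c c≤a))
    cases (inj₂ a≤c) (inj₂ b≤c) (inj₂ c≤b) = inj₂ (inj₂ (antisym b≤c c≤b , ≤-trans a≤c c≤b))

  tropComb-below-max : ∀ {m n} (a : Fin (suc n) → Carrier) (D : Fin (suc n) → Pt m) i j k l p q →
                       (∀ t → D t i j ≤ max (D t k l) (D t p q)) →
                       tropComb a D i j ≤ max (tropComb a D k l) (tropComb a D p q)
  tropComb-below-max a D i j k l p q below = tropComb-lub a D i j λ t →
    [ (λ ≤kl → ≤-trans (+-monoʳ-≤ (a t) ≤kl) (≤-trans (tropComb-ub a D t k l) (max-ubˡ _ _)))
    , (λ ≤pq → ≤-trans (+-monoʳ-≤ (a t) ≤pq) (≤-trans (tropComb-ub a D t p q) (max-ubʳ _ _)))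
    ]′ (≤-max-split (below t))

  tropComb-ultrametric : ∀ {m n} (a : Fin (suc n) → Carrier) (D : Fin (suc n) → Pt m) →
                         (∀ t → IsUltrametric (D t)) → IsUltrametric (tropComb a D)
  tropComb-ultrametric a D ultra i j k i<j j<k = ⇒maxTwice
    (tropComb-below-max a D i j i k j k λ t → proj₁ (maxTwice⇒ (ultra t i j k i<j j<k)))
    (tropComb-below-max a D i k i j j k λ t → proj₁ (proj₂ (maxTwice⇒ (ultra t i j k i<j j<k))))
    (tropComb-below-max a D j k i j i k λ t → proj₂ (proj₂ (maxTwice⇒ (ultra t i j k i<j j<k))))

  onCoords : ∀ {m} → Pt (suc (suc m)) → Pt (suc (suc m))
  onCoords φ i j with i Fin.<? j
  ... | yes _ = φ i j
  ... | no _ = φ Fin.zero (Fin.suc Fin.zero)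

  onCoords-coord : ∀ {m} (φ : Pt (suc (suc m))) i j → i Fin.< j → onCoords φ i j ≡ φ i j
  onCoords-coord φ i j i<j with i Fin.<? j
  ... | yes _ = refl
  ... | no i≮j = ⊥-elim (i≮j i<j)

  onCoords-other : ∀ {m} (φ : Pt (suc (suc m))) i j → ¬ (i Fin.< j) → onCoords φ i j ≡ φ Fin.zero (Fin.suc Fin.zero)
  onCoords-other φ i j i≮j with i Fin.<? j
  ... | yes i<j = ⊥-elim (i≮j i<j)
  ... | no _ = refl

  CoordArgmin : ∀ {m} → Pt m → Set
  CoordArgmin {m} φ = Σ (Fin m) λ i → Σ (Fin m) λ j → i Fin.< j × (∀ k l → k Fin.< l → φ i j ≤ φ k l)

  coordArgmin : ∀ {m} (φ : Pt (suc (suc m))) → CoordArgmin φ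
  coordArgmin {m} φ = [ genuine , degenerate ]′ (toSum (i* Fin.<? j*))
    where
    rowMin : ∀ i → Σ (Fin (suc (suc m))) λ j → ∀ l → onCoords φ i j ≤ onCoords φ i l
    rowMin i = argmin (suc m) (onCoords φ i)
    best : Σ (Fin (suc (suc m))) λ i → ∀ k → onCoords φ i (proj₁ (rowMin i)) ≤ onCoords φ k (proj₁ (rowMin k))
    best = argmin (suc m) (λ i → onCoords φ i (proj₁ (rowMin i)))
    i* j* : Fin (suc (suc m))
    i* = proj₁ best
    j* = proj₁ (rowMin i*)
    minimal : ∀ k l → k Fin.< l → onCoords φ i* j* ≤ φ k l
    minimal k l k<l = subst₂ _≤_ refl (onCoords-coord φ k l k<l)
      (≤-trans (proj₂ best k) (proj₂ (rowMin k) l))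
    genuine : i* Fin.< j* → CoordArgmin φ
    genuine i*<j* = i* , j* , i*<j* , λ k l k<l →
      subst₂ _≤_ (onCoords-coord φ i* j* i*<j*) refl (minimal k l k<l)
    degenerate : ¬ (i* Fin.< j*) → CoordArgmin φ
    degenerate i*≮j* = Fin.zero , Fin.suc Fin.zero , s≤s z≤n , λ k l k<l →
      subst₂ _≤_ (onCoords-other φ i* j* i*≮j*) refl (minimal k l k<l)

-- H(a) is the Fermat–Weber cost of the tropical combination with
-- coefficients a; its minimum over a large box is a Fermat–Weber point.
module FermatWeber (R : RealField) {m N : ℕ} (D : Fin (suc N) → Over.Pt R (suc (suc m))) where
  open RealField R
  open Over R
  open OrderedField R
  open ExtremeValue R
  open Tropical R
  open ≡ using (refl; sym; trans; cong; subst₂)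

  Coeffs : Set
  Coeffs = Fin (suc N) → Carrier

  H : Coeffs → Carrier
  H a = fwCost D (tropComb a D)

  H-nonneg : ∀ a → 0# ≤ H a
  H-nonneg a = bigSum-nonneg (suc N) λ t → dtr-nonneg (tropComb a D) (D t)

  -- ε-close coefficients give combinations within ε of each other, hence
  -- each distance dtr(tropComb a D, D t) moves by at most ε + ε
  H-uc : UniformlyContinuous (suc N) H
  H-uc = uc-bigSum (suc N) (λ t a → dtr (tropComb a D) (D t)) λ t δ 0<δ →
    let (h , h+h≡δ) = half δ
    in h , half-pos h+h≡δ 0<δ , λ a b close →
         subst₂ _≤_ refl (cong (dtr (tropComb b D) (D t) +_) h+h≡δ)
           (dtr-perturb (tropComb a D) (tropComb b D) (D t) h h
             (subst₂ _≤_ refl (sym h+h≡δ) (<⇒≤ 0<δ))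
             (λ i j _ → tropComb-shift a b D h (λ s → proj₁ (close s)) i j)
             (λ i j _ → tropComb-shift b a D h (λ s → proj₂ (close s)) i j))

  -- how far the D t are from D 0; bounds the normalised coefficients below
  spread : Carrier
  spread = bigMax (suc N) λ s → bigMax (suc (suc m)) λ i → bigMax (suc (suc m)) λ j →
             ∣ D Fin.zero i j - D s i j ∣

  spread-ub : ∀ s i j → ∣ D Fin.zero i j - D s i j ∣ ≤ spread
  spread-ub s i j =
    ≤-trans (bigMax-ub (suc (suc m)) (λ j → ∣ D Fin.zero i j - D s i j ∣) j)
   (≤-trans (bigMax-ub (suc (suc m)) (λ i → bigMax (suc (suc m)) λ j → ∣ D Fin.zero i j - D s i j ∣) i)
            (bigMax-ub (suc N) (λ s → bigMax (suc (suc m)) λ i → bigMax (suc (suc m)) λ j →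
                                         ∣ D Fin.zero i j - D s i j ∣) s))

  -spread≤spread : - spread ≤ spread
  -spread≤spread = ≤-trans (subst₂ _≤_ refl -0≡0 (neg-antitone 0≤spread)) 0≤spread
    where
    0≤spread : 0# ≤ spread
    0≤spread = ≤-trans (∣∣-nonneg _) (spread-ub Fin.zero Fin.zero Fin.zero)

  -- The projection of an arbitrary point y onto tconv(D): λ s is the minimum of
  -- y - D s over the coordinates, and π = ⊕ λ s ⊙ D s does not cost more than y.
  module Projection (y : Pt (suc (suc m))) where
    argmins : ∀ s → CoordArgmin (λ i j → y i j - D s i j)
    argmins s = coordArgmin (λ i j → y i j - D s i j)

    iₛ jₛ : Fin (suc N) → Fin (suc (suc m))
    iₛ s = proj₁ (argmins s)
    jₛ s = proj₁ (proj₂ (argmins s))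

    λₛ : Coeffs
    λₛ s = y (iₛ s) (jₛ s) - D s (iₛ s) (jₛ s)

    iₛ<jₛ : ∀ s → iₛ s Fin.< jₛ s
    iₛ<jₛ s = proj₁ (proj₂ (proj₂ (argmins s)))

    λₛ-min : ∀ s k l → k Fin.< l → λₛ s ≤ y k l - D s k l
    λₛ-min s = proj₂ (proj₂ (proj₂ (argmins s)))

    π : Pt (suc (suc m))
    π = tropComb λₛ D

    π≤y : ∀ k l → k Fin.< l → π k l ≤ y k l
    π≤y k l k<l = tropComb-lub λₛ D k l λ s → ≤-translate (D s k l) (λₛ-min s k l k<l) refl
      (solve 2 (λ y d → y ⊕ ⊝ d ⊕ d ⊜ y) refl (y k l) (D s k l))

    λₛ≤π-D : ∀ t k l → λₛ t ≤ π k l - D t k l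
    λₛ≤π-D t k l = ≤-translate (- D t k l) (tropComb-ub λₛ D t k l)
      (solve 2 (λ a d → a ⊕ d ⊕ ⊝ d ⊜ a) refl (λₛ t) (D t k l)) refl

    π-cost : fwCost D π ≤ fwCost D y
    π-cost = bigSum-mono (suc N) λ t →
      dtr-projection π y (D t) π≤y (iₛ t) (jₛ t) (iₛ<jₛ t) (λ k l _ → λₛ≤π-D t k l)

    -- normalising the first coefficient to 0 changes π only by a constant
    μ : Coeffs
    μ s = λₛ s - λₛ Fin.zero

    H-μ : H μ ≤ H λₛ
    H-μ = bigSum-mono (suc N) λ t → subst₂ _≤_ refl drop-zero
      (dtr-perturb (tropComb μ D) π (D t) (- λ₀) λ₀ (≤-reflexive (sym cancel))
        (λ i j _ → tropComb-shift μ λₛ D (- λ₀) (λ s → ≤-refl) i j)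
        (λ i j _ → tropComb-shift λₛ μ D λ₀ (λ s → ≤-reflexive
          (solve 2 (λ l l₀ → l ⊜ l ⊕ ⊝ l₀ ⊕ l₀) refl (λₛ s) λ₀)) i j))
      where
      λ₀ : Carrier
      λ₀ = λₛ Fin.zero
      cancel : - λ₀ + λ₀ ≡ 0#
      cancel = solve 1 (λ l → ⊝ l ⊕ l ⊜ 0ₑ) refl λ₀
      drop-zero : ∀ {d} → d + (- λ₀ + λ₀) ≡ d
      drop-zero {d} = trans (cong (d +_) cancel) (+-identityʳ d)

    -- comparing λ s with λ 0 at the minimising coordinates of y - D 0 and of y - D s
    μ-bounded : InBox (- spread) spread μ
    μ-bounded s = lower , upper
      where
      open import Relation.Binary.Reasoning.PartialOrder poset
      shift-diff : ∀ p q → (y p q - D s p q) - (y p q - D Fin.zero p q) ≡ D Fin.zero p q - D s p q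
      shift-diff p q =
        solve 3 (λ y d d₀ → y ⊕ ⊝ d ⊕ ⊝ (y ⊕ ⊝ d₀) ⊜ d₀ ⊕ ⊝ d) refl (y p q) (D s p q) (D Fin.zero p q)
      p₀ q₀ p q : Fin (suc (suc m))
      p₀ = iₛ Fin.zero
      q₀ = jₛ Fin.zero
      p = iₛ s
      q = jₛ s
      upper : μ s ≤ spread
      upper = begin
        μ s                                      ≤⟨ +-monoˡ-≤ (- λₛ Fin.zero) (λₛ-min s p₀ q₀ (iₛ<jₛ Fin.zero)) ⟩
        (y p₀ q₀ - D s p₀ q₀) - λₛ Fin.zero      ≡⟨ shift-diff p₀ q₀ ⟩
        D Fin.zero p₀ q₀ - D s p₀ q₀             ≤⟨ ∣∣-ub _ ⟩
        ∣ D Fin.zero p₀ q₀ - D s p₀ q₀ ∣        ≤⟨ spread-ub s p₀ q₀ ⟩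
        spread                                   ∎
      lower : - spread ≤ μ s
      lower = begin
        - spread                                 ≤⟨ neg-antitone (spread-ub s p q) ⟩
        - ∣ D Fin.zero p q - D s p q ∣          ≤⟨ -∣∣≤ _ ⟩
        D Fin.zero p q - D s p q                 ≡⟨ shift-diff p q ⟨
        λₛ s - (y p q - D Fin.zero p q)          ≤⟨ +-monoʳ-≤ (λₛ s) (neg-antitone (λₛ-min Fin.zero p q (iₛ<jₛ s))) ⟩
        μ s                                      ∎

  minimiser : Σ Coeffs λ a* → InBox (- spread) spread a* × (∀ a → InBox (- spread) spread a → H a* ≤ H a)
  minimiser = minimumOnBox (suc N) (- spread) spread -spread≤spread H 0# H-nonneg H-uc

  a* : Coeffs
  a* = proj₁ minimiser

  -- H(a*) ≤ H(μ) ≤ H(λ) = cost of π(y) ≤ cost of y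
  isFermatWeber : IsFermatWeber D (tropComb a* D)
  isFermatWeber y = ≤-trans (proj₂ (proj₂ minimiser) μ μ-bounded) (≤-trans H-μ π-cost)
    where open Projection y

  inTconv : InTconv D (tropComb a* D)
  inTconv = a* , 0# , λ i j _ → sym (+-identityʳ _)

open import Data.Nat using (_≤_)

mainTheorem3 : (R : RealField) → let open Over R in
    (m n : ℕ) → 2 ≤ m → 3 ≤ n → (D : Fin n → Pt m) →
    (∀ t → IsUltrametric (D t)) →
    Σ (Pt m) λ x → IsFermatWeber D x × InTconv D x × IsUltrametric x
mainTheorem3 R (suc (suc m)) (suc N) (s≤s (s≤s _)) (s≤s _) D ultra =
  tropComb a* D , isFermatWeber , inTconv , tropComb-ultrametric a* D ultra
  where
  open Over R using (tropComb)
  open Tropical R using (tropComb-ultrametric)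
  open FermatWeber R D using (a*; isFermatWeber; inTconv)
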